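{- Let $\mathcal{G}=(V,\mathcal{E},T)$ be a happy temporally connected temporal graph, and let $X\subseteq V$ be a vertex cover of the underlying graph of $\mathcal{G}$ with $|X|=d$. Let $\mathcal{S}$ be a minimum temporal spanner of $\mathcal{G}$ (one with the fewest time edges). Then the set of time edges of $\mathcal{S}$ is the union of the time-edge sets of at most $d$ temporal out-trees rooted in vertices of $X$, together with at most one extra time edge incident to each vertex of $V\setminus X$.
   Context: A temporal graph is a triple $\mathcal{G}=(V,\mathcal{E},T)$ with finite vertex set $V$, positive integer $T$ and set of time edges $\mathcal{E}\subseteq \binom{V}{2}\times\{1,\dots,T\}$; its underlying graph is the static graph on $V$ whose edges are the pairs occurring in $\mathcal{E}$. $\mathcal{G}$ is happy if every pair occurs in at most one time edge and any two distinct time edges sharing an endpoint have different labels. A temporal path is a sequence of time edges $((e_1,t_1),\dots,(e_\ell,t_\ell))$ in $\mathcal{E}$ with $e_1,\dots,e_\ell$ forming a path in the underlying graph and $t_1\le\dots\le t_\ell$. $\mathcal{G}$ is temporally connected if every vertex has a temporal path to every other vertex. A temporal spanner of $\mathcal{G}$ is a temporally connected $(V,\mathcal{E}',T')$ with $\mathcal{E}'\subseteq\mathcal{E}$, $T'\le T$. A temporal out-tree rooted in a vertex $r$ is a temporal graph on $V$ (with time edges from $\mathcal{E}$) whose underlying graph is a spanning tree and in which $r$ has a temporal path to every vertex. -}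

module Defs where

open import Data.Nat using (ℕ; _≤_)
open import Data.Fin using (Fin)
open import Data.Fin.Subset using (Subset; ∣_∣) renaming (_∈_ to _∈ₛ_; _∉_ to _∉ₛ_)
open import Data.List using (List; []; _∷_; length)
open import Data.List.Membership.Propositional using (_∈_)
open import Data.List.Relation.Unary.Unique.Propositional using (Unique)
open import Data.List.Relation.Unary.All using (All)
open import Data.List.Relation.Unary.Any using (Any)
open import Data.List.Relation.Binary.Sublist.Propositional using () renaming (_⊆_ to _⊑_)
open import Data.Maybe using (Maybe; just)
open import Data.Product using (Σ; ∃; _×_; _,_; proj₁; proj₂)
open import Data.Sum using (_⊎_)
open import Function.Bundles using (_⇔_)
open import Relation.Binary.PropositionalEquality using (_≡_; _≢_)
open import Relation.Nullary using (¬_)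

-- Vertex set V = Fin n.  A time edge ({u,v}, t); the orientation (u,v) in the
-- record is immaterial: all notions below treat {u,v} as unordered.
record TE (n : ℕ) : Set where
  constructor te
  field
    u : Fin n
    v : Fin n
    t : ℕ
open TE public

module _ {n : ℕ} where

  TAdj : List (TE n) → Fin n → Fin n → ℕ → Set
  TAdj F x y s = (te x y s ∈ F) ⊎ (te y x s ∈ F)

  Adj : List (TE n) → Fin n → Fin n → Set
  Adj F x y = ∃ λ s → TAdj F x y s

  SamePair : TE n → TE n → Set
  SamePair e e' = (u e ≡ u e' × v e ≡ v e') ⊎ (u e ≡ v e' × v e ≡ u e')

  Incident : TE n → Fin n → Set
  Incident e x = (u e ≡ x) ⊎ (v e ≡ x)

  ShareEndpoint : TE n → TE n → Set
  ShareEndpoint e e' = ∃ λ x → Incident e x × Incident e' x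

  IsTGraph : ℕ → List (TE n) → Set
  IsTGraph T E = Unique E × (∀ {e} → e ∈ E → (u e ≢ v e) × (1 ≤ t e) × (t e ≤ T))

  Happy : List (TE n) → Set
  Happy E =
    (∀ {e e'} → e ∈ E → e' ∈ E → SamePair e e' → e ≡ e') ×
    (∀ {e e'} → e ∈ E → e' ∈ E → e ≢ e' → ShareEndpoint e e' → t e ≢ t e')

  data TWalk (F : List (TE n)) : ℕ → Fin n → Fin n → List (Fin n) → Set where
    stop : ∀ {s x} → TWalk F s x x (x ∷ [])
    step : ∀ {s r x y z vs} → s ≤ r → TAdj F x y r → TWalk F r y z vs →
           TWalk F s x z (x ∷ vs)

  TPath : List (TE n) → Fin n → Fin n → Set
  TPath F x y = ∃ λ vs → TWalk F 0 x y vs × Unique vs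

  TemporallyConnected : List (TE n) → Set
  TemporallyConnected F = ∀ x y → x ≢ y → TPath F x y

  data Walk (F : List (TE n)) : Fin n → Fin n → List (Fin n) → Set where
    stop : ∀ {x} → Walk F x x (x ∷ [])
    step : ∀ {x y z vs} → Adj F x y → Walk F y z vs → Walk F x z (x ∷ vs)

  Connected : List (TE n) → Set
  Connected F = ∀ x y → ∃ λ vs → Walk F x y vs

  Acyclic : List (TE n) → Set
  Acyclic F = ∀ x y vs → Walk F x y vs → Unique vs → 3 ≤ length vs → ¬ Adj F y x

  SpanningTree : List (TE n) → Set
  SpanningTree F = Connected F × Acyclic F

  OutTree : List (TE n) → Fin n → List (TE n) → Set
  OutTree E r F = (∀ {e} → e ∈ F → e ∈ E) × Unique F × SpanningTree F ×
                  (∀ x → x ≢ r → TPath F r x)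

  IsSpanner : ℕ → List (TE n) → ℕ → List (TE n) → Set
  IsSpanner T E T' E' = (E' ⊑ E) × T' ≤ T × (∀ {e} → e ∈ E' → t e ≤ T') ×
                        TemporallyConnected E'

  -- minimum temporal spanner (fewest time edges; E' ⊑ E and E unique, so
  -- length = number of time edges)
  IsMinimumSpanner : ℕ → List (TE n) → ℕ → List (TE n) → Set
  IsMinimumSpanner T E T' E' =
    IsSpanner T E T' E' × (∀ T'' E'' → IsSpanner T E T'' E'' → length E' ≤ length E'')

  VertexCover : List (TE n) → Subset n → Set
  VertexCover E X = ∀ {e} → e ∈ E → (u e ∈ₛ X) ⊎ (v e ∈ₛ X)

  Decomposition : List (TE n) → Subset n → ℕ → List (TE n) → Set
  Decomposition E X d S =
    Σ (List (Fin n × List (TE n))) λ trees →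
      (length trees ≤ d) ×
      All (λ p → (proj₁ p ∈ₛ X) × OutTree E (proj₁ p) (proj₂ p)) trees ×
      Σ (Fin n → Maybe (TE n)) λ extra →
        (∀ x e → extra x ≡ just e → (x ∉ₛ X) × Incident e x) ×
        (∀ e → (e ∈ S) ⇔ (Any (λ p → e ∈ proj₂ p) trees ⊎ ∃ λ x → extra x ≡ just e))

{-# OPTIONS --safe #-}

-- For each vertex a outside the cover X let extra(a) be an earliest time edge of S at a; its other
-- endpoint lies in X. For x ∈ X let τ(x) be the latest label of an extra edge at x (0 if there is
-- none). Then x reaches every vertex of S using only labels ≥ τ(x): it first moves to the owner a of
-- that extra edge, and any temporal path of S leaving a starts no earlier. So the edges of S with
-- label ≥ τ(x) contain a temporal out-tree rooted at x. These trees and the extra edges form a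
-- temporally connected part of S, since a vertex outside X can take its extra edge into X and
-- continue on the tree there, which starts late enough. By minimality this part is all of S.
module Submission where

open import Defs
open import Level using (0ℓ)
open import Data.Nat using (ℕ; zero; suc; _≤_; _<_; z≤n; s≤s; _≤?_) renaming (_≟_ to _≟ℕ_)
open import Data.Nat.Properties
  using (≤-refl; ≤-trans; ≤-reflexive; ≤-pred; <-≤-trans; <⇒≱; ≤-totalOrder)
open import Data.Fin using (Fin; zero; suc) renaming (_≟_ to _≟ᶠ_)
open import Data.Fin.Properties using (any?)
open import Data.Fin.Subset using (Subset; ∣_∣; inside; outside) renaming (_∈_ to _∈ₛ_; _∉_ to _∉ₛ_)
open import Data.Fin.Subset.Properties using (_∈?_)
open import Data.Vec.Base using ([]; _∷_; here; there)
open import Data.Vec.Functional using (updateAt)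
open import Data.Vec.Functional.Properties using (updateAt-updates; updateAt-minimal)
open import Data.List using (List; []; _∷_; _∷ʳ_; length; filter; map; allFin)
open import Data.List.Properties using (filter-notAll; length-map)
open import Data.List.Membership.Propositional using (_∈_; _∉_)
open import Data.List.Membership.Propositional.Properties using (∈-filter⁺; ∈-filter⁻; ∈-allFin; ∈-map⁺)
open import Data.List.Relation.Binary.Subset.Propositional using (_⊆_)
open import Data.List.Relation.Binary.Sublist.Propositional
  using () renaming (_⊆_ to _⊑_; ⊆-trans to ⊑-trans; lookup to ⊑-lookup)
open import Data.List.Relation.Binary.Sublist.Propositional.Properties using (filter-⊆)
open import Data.List.Relation.Unary.Any as Any using (Any; here; there)
open import Data.List.Relation.Unary.Any.Properties using () renaming (map⁺ to Any-map⁺; map⁻ to Any-map⁻)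
open import Data.List.Relation.Unary.All as All using (All; []; _∷_)
open import Data.List.Relation.Unary.All.Properties
  using (¬Any⇒All¬; All¬⇒¬Any; ∷ʳ⁺) renaming (map⁺ to All-map⁺)
open import Data.List.Relation.Unary.AllPairs using ([]; _∷_)
open import Data.List.Relation.Unary.Unique.Propositional using (Unique)
import Data.List.Relation.Unary.Unique.Propositional.Properties as Unique
import Data.List.Extrema as Extrema
open import Data.Maybe using (Maybe; just; nothing)
open import Data.Maybe.Properties using (≡-dec)
open import Data.Product using (Σ; ∃; ∃₂; _×_; _,_; proj₁; proj₂)
import Data.Product as Product
open import Data.Sum using (_⊎_; inj₁; inj₂; [_,_])
import Data.Sum as Sum
open import Data.Empty using (⊥; ⊥-elim)
open import Function using (_∘_; const; case_of_)
open import Function.Bundles using (mk⇔)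
open import Relation.Binary.Bundles using (TotalOrder)
import Relation.Binary.Construct.Flip.Ord as Flip
open import Relation.Nullary using (¬_; Dec; yes; no)
open import Relation.Nullary.Decidable using (_×-dec_; _⊎-dec_; ¬?)
open import Relation.Unary using (Pred; Decidable)
open import Relation.Binary.PropositionalEquality using (_≡_; _≢_; refl; sym; trans; cong; subst)

module _ {A : Set} (O : TotalOrder 0ℓ 0ℓ 0ℓ) (f : A → TotalOrder.Carrier O) where
  open TotalOrder O using () renaming (_≤_ to _≼_)
  open Extrema O using (argmin; argmin-all; f[argmin]≤f[⊤]; f[argmin]≤f[xs])

  Least : Pred A 0ℓ → List A → A → Set
  Least P xs m = m ∈ xs × P m × (∀ {x} → x ∈ xs → P x → f m ≼ f x)

  least? : {P : Pred A 0ℓ} → Decidable P → (xs : List A) →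
           ∃ (Least P xs) ⊎ (∀ {x} → x ∈ xs → ¬ P x)
  least? {P} P? xs
    with filter P? xs | (λ {x} → ∈-filter⁺ P? {x} {xs}) | (λ {v} → ∈-filter⁻ P? {v = v} {xs = xs})
  ... | []     | into | _   = inj₂ λ x∈xs px → case into x∈xs px of λ ()
  ... | c ∷ cs | into | out = inj₁ (argmin f c cs , proj₁ chosen , proj₂ chosen , below)
    where
    chosen : argmin f c cs ∈ xs × P (argmin f c cs)
    chosen = out (argmin-all f {P = _∈ c ∷ cs} (here refl) (All.tabulate there))
    below : ∀ {x} → x ∈ xs → P x → f (argmin f c cs) ≼ f x
    below x∈xs px with into x∈xs px
    ... | here refl = f[argmin]≤f[⊤] {f = f} c cs
    ... | there x∈cs = All.lookup (f[argmin]≤f[xs] {f = f} c cs) x∈cs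

elements : ∀ {n} → Subset n → List (Fin n)
elements [] = []
elements (inside ∷ p)  = zero ∷ map suc (elements p)
elements (outside ∷ p) = map suc (elements p)

length-elements : ∀ {n} (p : Subset n) → length (elements p) ≡ ∣ p ∣
length-elements [] = refl
length-elements (inside ∷ p)  = cong suc (trans (length-map suc (elements p)) (length-elements p))
length-elements (outside ∷ p) = trans (length-map suc (elements p)) (length-elements p)

∈-elements⁺ : ∀ {n} {p : Subset n} {x} → x ∈ₛ p → x ∈ elements p
∈-elements⁺ {p = inside ∷ _}  here        = here refl
∈-elements⁺ {p = inside ∷ _}  (there x∈p) = there (∈-map⁺ suc (∈-elements⁺ x∈p))
∈-elements⁺ {p = outside ∷ _} (there x∈p) = ∈-map⁺ suc (∈-elements⁺ x∈p)

elements-inside : ∀ {n} (p : Subset n) → All (_∈ₛ p) (elements p)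
elements-inside [] = []
elements-inside (inside ∷ p)  = here ∷ All-map⁺ (All.map there (elements-inside p))
elements-inside (outside ∷ p) = All-map⁺ (All.map there (elements-inside p))

module _ {n : ℕ} where

  private variable
    F G : List (TE n)
    e : TE n
    a b x y z : Fin n
    r s s′ τ τ′ : ℕ
    root : Fin n
    vs ws : List (Fin n)

  TAdj-swap : TAdj F x y s → TAdj F y x s
  TAdj-swap = Sum.swap

  TAdj-mono : F ⊆ G → TAdj F x y s → TAdj G x y s
  TAdj-mono F⊆G = Sum.map F⊆G F⊆G

  TAdj-incident : e ∈ F → Incident e x → Incident e y → x ≢ y → TAdj F x y (t e)
  TAdj-incident {e = te _ _ _} e∈F (inj₁ refl) (inj₁ refl) x≢y = ⊥-elim (x≢y refl)
  TAdj-incident {e = te _ _ _} e∈F (inj₁ refl) (inj₂ refl) _   = inj₁ e∈F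
  TAdj-incident {e = te _ _ _} e∈F (inj₂ refl) (inj₁ refl) _   = inj₂ e∈F
  TAdj-incident {e = te _ _ _} e∈F (inj₂ refl) (inj₂ refl) x≢y = ⊥-elim (x≢y refl)

  TAdj-label : (∀ {e} → e ∈ F → τ ≤ t e) → TAdj F x y s → τ ≤ s
  TAdj-label late = [ late , late ]

  TWalk-mono : F ⊆ G → TWalk F s x y vs → TWalk G s x y vs
  TWalk-mono F⊆G stop = stop
  TWalk-mono F⊆G (step s≤r xy w) = step s≤r (TAdj-mono F⊆G xy) (TWalk-mono F⊆G w)

  TWalk-earlier : s′ ≤ s → TWalk F s x y vs → TWalk F s′ x y vs
  TWalk-earlier s′≤s stop = stop
  TWalk-earlier s′≤s (step s≤r xy w) = step (≤-trans s′≤s s≤r) xy w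

  TWalk-from : (∀ {e} → e ∈ F → τ ≤ t e) → TWalk F s x y vs → TWalk F τ x y vs
  TWalk-from late stop = stop
  TWalk-from late (step _ xy w) = step (TAdj-label late xy) xy w

  TWalk-suffix : TWalk F s x y vs → Unique vs → z ∈ vs → ∃ λ ws → TWalk F s z y ws × Unique ws
  TWalk-suffix stop           uq (here refl) = _ , stop , uq
  TWalk-suffix w@(step _ _ _) uq (here refl) = _ , w , uq
  TWalk-suffix (step s≤r xy w) (_ ∷ uq) (there z∈vs) =
    Product.map₂ (Product.map₁ (TWalk-earlier s≤r)) (TWalk-suffix w uq z∈vs)

  shortcut : TWalk F s x y vs → ∃ λ ws → TWalk F s x y ws × Unique ws
  shortcut stop = _ , stop , [] ∷ []
  shortcut {x = x} (step s≤r xy w) with shortcut w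
  ... | ws , w' , uq with Any.any? (x ≟ᶠ_) ws
  ...   | yes x∈ws = TWalk-suffix (TWalk-earlier s≤r w') uq x∈ws
  ...   | no x∉ws  = x ∷ ws , step s≤r xy w' , ¬Any⇒All¬ ws x∉ws ∷ uq

  TWalk⇒TPath : TWalk F s x y vs → TPath F x y
  TWalk⇒TPath w = Product.map₂ (Product.map₁ (TWalk-earlier z≤n)) (shortcut w)

  Late : ℕ → List (TE n) → List (TE n)
  Late τ = filter (λ e → τ ≤? t e)

  Late⊆ : ∀ F → Late τ F ⊆ F
  Late⊆ F = proj₁ ∘ ∈-filter⁻ _ {xs = F}

  Late-≥ : ∀ F → e ∈ Late τ F → τ ≤ t e
  Late-≥ F = proj₂ ∘ ∈-filter⁻ _ {xs = F}

  TWalk-late : τ ≤ s → TWalk F s x y vs → TWalk (Late τ F) s x y vs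
  TWalk-late τ≤s stop = stop
  TWalk-late {τ} {F = F} τ≤s (step {r = r} s≤r xy w) =
    step s≤r (Sum.map keep keep xy) (TWalk-late (≤-trans τ≤s s≤r) w)
    where
    keep : te a b r ∈ F → te a b r ∈ Late τ F
    keep e∈F = ∈-filter⁺ _ e∈F (≤-trans τ≤s s≤r)

  Adj-sym : Adj F x y → Adj F y x
  Adj-sym = Product.map₂ TAdj-swap

  TWalk⇒Walk : TWalk F s x y vs → Walk F x y vs
  TWalk⇒Walk stop = stop
  TWalk⇒Walk (step _ xy w) = step (_ , xy) (TWalk⇒Walk w)

  Walk-++ : Walk F x y vs → Walk F y z ws → ∃ (Walk F x z)
  Walk-++ stop w' = _ , w'
  Walk-++ (step xy w) w' with Walk-++ w w'
  ... | _ , w'' = _ , step xy w''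

  Walk-reverse : Walk F x y vs → ∃ (Walk F y x)
  Walk-reverse stop = _ , stop
  Walk-reverse (step xy w) = Walk-++ (proj₂ (Walk-reverse w)) (step (Adj-sym xy) stop)

  Walk-head∈ : Walk F x y vs → x ∈ vs
  Walk-head∈ stop = here refl
  Walk-head∈ (step _ _) = here refl

  Walk-last∈ : Walk F x y vs → y ∈ vs
  Walk-last∈ stop = here refl
  Walk-last∈ (step _ w) = there (Walk-last∈ w)

  closed-path-trivial : Walk F x x vs → Unique vs → length vs ≡ 1
  closed-path-trivial stop _ = refl
  closed-path-trivial (step _ w) (x∉ ∷ _) = ⊥-elim (All¬⇒¬Any x∉ (Walk-last∈ w))

  module _ {T T′ : List (TE n)}
           (leaf : ∀ {p} → Adj T′ p b → p ≡ a)
           (rest : ∀ {p q} → Adj T′ p q → p ≢ b → q ≢ b → Adj T p q) where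

    private
      leaf′ : ∀ {q} → Adj T′ b q → q ≡ a
      leaf′ = leaf ∘ Adj-sym

      no-triangle : Walk T′ x x vs → Unique vs → 3 ≤ suc (length vs) → ⊥
      no-triangle w uq len with subst (λ k → 3 ≤ suc k) (closed-path-trivial w uq) len
      ... | s≤s (s≤s ())

    Walk-avoiding : Walk T′ x y vs → b ∉ vs → Walk T x y vs
    Walk-avoiding stop _ = stop
    Walk-avoiding (step xy w) b∉ =
      step (rest xy (b∉ ∘ here ∘ sym) (λ { refl → b∉ (there (Walk-head∈ w)) }))
           (Walk-avoiding w (b∉ ∘ there))

    enters-b-from-a : Walk T′ x b vs → x ≢ b → a ∈ vs
    enters-b-from-a stop x≢b = ⊥-elim (x≢b refl)
    enters-b-from-a (step {y = y} xy w) x≢b with y ≟ᶠ b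
    ... | yes refl = here (sym (leaf xy))
    ... | no y≢b   = there (enters-b-from-a w y≢b)

    b-not-inside : Walk T′ x y vs → Unique vs → x ≢ b → y ≢ b → b ∉ vs
    b-not-inside stop       _ x≢b _ (here b≡x) = x≢b (sym b≡x)
    b-not-inside (step _ _) _ x≢b _ (here b≡x) = x≢b (sym b≡x)
    b-not-inside stop _ _ _ (there ())
    b-not-inside (step {y = z} xz w) (_ ∷ uq) x≢b y≢b (there b∈) with z ≟ᶠ b
    ... | no z≢b = b-not-inside w uq z≢b y≢b b∈
    b-not-inside (step xz stop) _ _ y≢b _ | yes refl = y≢b refl
    b-not-inside (step xz (step bz′ w)) (x∉ ∷ _) _ _ _ | yes refl =
      All¬⇒¬Any x∉ (there (subst (_∈ _) (trans (leaf′ bz′) (sym (leaf xz))) (Walk-head∈ w)))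

    acyclic-leaf : Acyclic T → Acyclic T′
    acyclic-leaf acyc x y vs w uq len yx with x ≟ᶠ b | y ≟ᶠ b
    ... | yes refl | _ = cycle-from-b w uq len yx
      where
      cycle-from-b : Walk T′ b y vs → Unique vs → 3 ≤ length vs → Adj T′ y b → ⊥
      cycle-from-b (step bz w) (_ ∷ uq) len yb with leaf′ bz | leaf yb
      ... | refl | refl = no-triangle w uq len
      cycle-from-b stop _ (s≤s ()) _
    ... | no x≢b | yes refl = cycle-to-b w uq len x≢b yx
      where
      cycle-to-b : Walk T′ x b vs → Unique vs → 3 ≤ length vs → x ≢ b → Adj T′ b x → ⊥
      cycle-to-b stop _ _ x≢b _ = x≢b refl
      cycle-to-b (step {y = z} xz w) (x∉ ∷ uq) len x≢b bx with z ≟ᶠ b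
      ... | yes refl = no-triangle w uq len
      ... | no z≢b   = All¬⇒¬Any x∉ (subst (_∈ _) (sym (leaf′ bx)) (enters-b-from-a w z≢b))
    ... | no x≢b | no y≢b =
      acyc x y vs (Walk-avoiding w (b-not-inside w uq x≢b y≢b)) uq len (rest yx y≢b x≢b)

  Incident-endpoint : {Q : Fin n → Set} → Incident e x → Q (u e) × Q (v e) → Q x
  Incident-endpoint (inj₁ refl) = proj₁
  Incident-endpoint (inj₂ refl) = proj₂

  OutTree-walk : ∀ {T} → OutTree F root T → ∀ y → ∃ (TWalk T 0 root y)
  OutTree-walk {root = root} (_ , _ , _ , path) y with y ≟ᶠ root
  ... | yes refl = _ , stop
  ... | no y≢root = Product.map₂ proj₁ (path y y≢root)

  OutTree-mono : ∀ {T} → F ⊆ G → OutTree F root T → OutTree G root T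
  OutTree-mono F⊆G = Product.map₁ λ T⊆F → F⊆G ∘ T⊆F

  data TWalkBy (F : List (TE n)) : ℕ → ℕ → Fin n → Fin n → List (Fin n) → Set where
    stop : s ≤ τ → TWalkBy F s τ x x (x ∷ [])
    step : s ≤ r → TAdj F x y r → TWalkBy F r τ y z vs → TWalkBy F s τ x z (x ∷ vs)

  TWalkBy⇒TWalk : TWalkBy F s τ x y vs → TWalk F s x y vs
  TWalkBy⇒TWalk (stop _) = stop
  TWalkBy⇒TWalk (step s≤r xy w) = step s≤r xy (TWalkBy⇒TWalk w)

  TWalkBy-mono : F ⊆ G → TWalkBy F s τ x y vs → TWalkBy G s τ x y vs
  TWalkBy-mono F⊆G (stop s≤τ) = stop s≤τ
  TWalkBy-mono F⊆G (step s≤r xy w) = step s≤r (TAdj-mono F⊆G xy) (TWalkBy-mono F⊆G w)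

  TWalkBy-later : τ ≤ τ′ → TWalkBy F s τ x y vs → TWalkBy F s τ′ x y vs
  TWalkBy-later τ≤τ′ (stop s≤τ) = stop (≤-trans s≤τ τ≤τ′)
  TWalkBy-later τ≤τ′ (step s≤r xy w) = step s≤r xy (TWalkBy-later τ≤τ′ w)

  TWalkBy-snoc : TWalkBy F s τ x y vs → τ ≤ r → TAdj F y z r → TWalkBy F s r x z (vs ∷ʳ z)
  TWalkBy-snoc (stop s≤τ) τ≤r yz = step (≤-trans s≤τ τ≤r) yz (stop ≤-refl)
  TWalkBy-snoc (step s≤r′ xy w) τ≤r yz = step s≤r′ xy (TWalkBy-snoc w τ≤r yz)

  edgeOf : TAdj F x y s → TE n
  edgeOf {x = x} {y} {s} (inj₁ _) = te x y s
  edgeOf {x = x} {y} {s} (inj₂ _) = te y x s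

  edgeOf∈ : (xy : TAdj F x y s) → edgeOf xy ∈ F
  edgeOf∈ (inj₁ e∈F) = e∈F
  edgeOf∈ (inj₂ e∈F) = e∈F

  edgeOf-incident : (xy : TAdj F x y s) → Incident (edgeOf xy) y
  edgeOf-incident (inj₁ _) = inj₂ refl
  edgeOf-incident (inj₂ _) = inj₁ refl

  edgeOf-endpoints : {Q : Fin n → Set} (xy : TAdj F x y s) → Q x → Q y → Q (u (edgeOf xy)) × Q (v (edgeOf xy))
  edgeOf-endpoints (inj₁ _) qx qy = qx , qy
  edgeOf-endpoints (inj₂ _) qx qy = qy , qx

  TAdj-edgeOf : (xy : TAdj F x y s) → TAdj (edgeOf xy ∷ G) x y s
  TAdj-edgeOf (inj₁ _) = inj₁ (here refl)
  TAdj-edgeOf (inj₂ _) = inj₂ (here refl)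

  Adj-edgeOf⁻ : (xy : TAdj F x y s) → Adj (edgeOf xy ∷ G) a b →
                Adj G a b ⊎ (a ≡ x × b ≡ y) ⊎ (a ≡ y × b ≡ x)
  Adj-edgeOf⁻ _        (_ , inj₁ (there ab)) = inj₁ (_ , inj₁ ab)
  Adj-edgeOf⁻ _        (_ , inj₂ (there ba)) = inj₁ (_ , inj₂ ba)
  Adj-edgeOf⁻ (inj₁ _) (_ , inj₁ (here refl)) = inj₂ (inj₁ (refl , refl))
  Adj-edgeOf⁻ (inj₂ _) (_ , inj₁ (here refl)) = inj₂ (inj₂ (refl , refl))
  Adj-edgeOf⁻ (inj₁ _) (_ , inj₂ (here refl)) = inj₂ (inj₂ (refl , refl))
  Adj-edgeOf⁻ (inj₂ _) (_ , inj₂ (here refl)) = inj₂ (inj₁ (refl , refl))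

  _≟ᵉ_ : (e e′ : TE n) → Dec (e ≡ e′)
  te a b s ≟ᵉ te a′ b′ s′ with a ≟ᶠ a′ | b ≟ᶠ b′ | s ≟ℕ s′
  ... | yes refl | yes refl | yes refl = yes refl
  ... | no a≢a′  | _        | _        = no λ { refl → a≢a′ refl }
  ... | yes _    | no b≢b′  | _        = no λ { refl → b≢b′ refl }
  ... | yes _    | yes _    | no s≢s′  = no λ { refl → s≢s′ refl }

  incident? : (x : Fin n) → Decidable (λ e → Incident e x)
  incident? x e = (u e ≟ᶠ x) ⊎-dec (v e ≟ᶠ x)

  Earliest : List (TE n) → Fin n → TE n → Set
  Earliest F a = Least ≤-totalOrder t (λ e → Incident e a) F

  TPath-incident : TPath F x y → x ≢ y → ∃ λ e → e ∈ F × Incident e x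
  TPath-incident (_ , stop , _) x≢x = ⊥-elim (x≢x refl)
  TPath-incident (_ , step _ (inj₁ e∈F) _ , _) _ = _ , e∈F , inj₁ refl
  TPath-incident (_ , step _ (inj₂ e∈F) _ , _) _ = _ , e∈F , inj₂ refl

  walk-between : TemporallyConnected F → ∀ x y → ∃ (TWalk F 0 x y)
  walk-between conn x y with y ≟ᶠ x
  ... | yes refl = _ , stop
  ... | no y≢x   = Product.map₂ proj₁ (conn x y (y≢x ∘ sym))

  -- Every walk leaving a starts with an edge at a, hence no earlier than its earliest edge e;
  -- prefixing e turns this into walks from the other endpoint of e.
  earliest-reach : TemporallyConnected F → Earliest F a e → Incident e x → ∀ y → ∃ (TWalk F (t e) x y)
  earliest-reach {F} {a} {e} {x} conn (e∈F , e-at-a , e-first) e-at-x y = from-x (x ≟ᶠ a)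
    where
    delay : TWalk F s a y vs → TWalk F (t e) a y vs
    delay stop = stop
    delay (step _ (inj₁ e′∈F) w) = step (e-first e′∈F (inj₁ refl)) (inj₁ e′∈F) w
    delay (step _ (inj₂ e′∈F) w) = step (e-first e′∈F (inj₂ refl)) (inj₂ e′∈F) w
    from-a : ∃ (TWalk F (t e) a y)
    from-a = Product.map₂ delay (walk-between conn a y)
    from-x : Dec (x ≡ a) → ∃ (TWalk F (t e) x y)
    from-x (yes refl) = from-a
    from-x (no x≢a)   = Product.map (x ∷_) (step ≤-refl (TAdj-incident e∈F e-at-x e-at-a x≢a)) from-a

-- Growing a temporal out-tree

module _ {n : ℕ} (F : List (TE n)) (r : Fin n) where

  private variable
    a b c p q x y z : Fin n
    s s′ : ℕ
    vs : List (Fin n)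

  -- Grown like Dijkstra's algorithm: each step adds the earliest edge of F leaving the reached set
  -- at a time when its reached endpoint is already reached. `closed` and `exits-late` say that no
  -- edge of F reaches a vertex earlier than recorded; thanks to them a temporal walk of F from r
  -- can be followed inside the reached set until it leaves along such an edge.
  record PartialOutTree : Set₁ where
    field
      Reached            : Fin n → Set
      reached?           : Decidable Reached
      arrival            : Fin n → ℕ
      edges              : List (TE n)
      unreached          : List (Fin n)
      root-reached       : Reached r
      arrival-root       : arrival r ≡ 0
      edges⊆F            : edges ⊆ F
      edges-inside       : ∀ {e} → e ∈ edges → Reached (u e) × Reached (v e)
      edges-unique       : Unique edges
      edges-acyclic      : Acyclic edges
      route              : Reached x → ∃ λ vs → TWalkBy edges 0 (arrival x) r x vs × Unique vs × All Reached vs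
      closed             : TAdj F a b s → Reached a → arrival a ≤ s → Reached b → arrival b ≤ s
      exits-late         : TAdj F a b s → Reached a → ¬ Reached b → arrival a ≤ s → Reached c → arrival c ≤ s
      unreached-complete : ¬ Reached x → x ∈ unreached

  start : PartialOutTree
  start = record
    { Reached = _≡ r ; reached? = _≟ᶠ r ; arrival = const 0 ; edges = [] ; unreached = allFin n
    ; root-reached = refl ; arrival-root = refl ; edges⊆F = λ () ; edges-inside = λ ()
    ; edges-unique = [] ; edges-acyclic = λ { _ _ _ _ _ _ (_ , inj₁ ()) ; _ _ _ _ _ _ (_ , inj₂ ()) }
    ; route = λ { refl → _ , stop z≤n , [] ∷ [] , refl ∷ [] }
    ; closed = λ _ _ _ _ → z≤n ; exits-late = λ _ _ _ _ _ → z≤n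
    ; unreached-complete = λ {x} _ → ∈-allFin x
    }

  module _ (P : PartialOutTree) where
    open PartialOutTree P

    Exit : Fin n → Fin n → ℕ → Set
    Exit a b s = Reached a × ¬ Reached b × arrival a ≤ s

    Leaving : TE n → Set
    Leaving e = Exit (u e) (v e) (t e) ⊎ Exit (v e) (u e) (t e)

    leaving? : Decidable Leaving
    leaving? e = exit? (u e) (v e) (t e) ⊎-dec exit? (v e) (u e) (t e)
      where
      exit? : ∀ a b s → Dec (Exit a b s)
      exit? a b s = reached? a ×-dec ¬? (reached? b) ×-dec (arrival a ≤? s)

    exit-leaving : TAdj F a b s → Exit a b s → ∃ λ e → e ∈ F × Leaving e × t e ≡ s
    exit-leaving (inj₁ e∈F) ex = _ , e∈F , inj₁ ex , refl
    exit-leaving (inj₂ e∈F) ex = _ , e∈F , inj₂ ex , refl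

    leaving-exit : ∀ {e} → e ∈ F → Leaving e → ∃₂ λ a b → TAdj F a b (t e) × Exit a b (t e)
    leaving-exit {te _ _ _} e∈F (inj₁ ex) = _ , _ , inj₁ e∈F , ex
    leaving-exit {te _ _ _} e∈F (inj₂ ex) = _ , _ , inj₂ e∈F , ex

    walk-exits : TWalk F s x z vs → Reached x → arrival x ≤ s → ¬ Reached z →
                 ∃₂ λ a b → ∃ λ s′ → TAdj F a b s′ × Exit a b s′
    walk-exits stop Rx _ z∉R = ⊥-elim (z∉R Rx)
    walk-exits (step {y = y} s≤r xy w) Rx x≤s z∉R with reached? y
    ... | yes Ry = walk-exits w Ry (closed xy Rx (≤-trans x≤s s≤r) Ry) z∉R
    ... | no y∉R = _ , _ , _ , xy , Rx , y∉R , ≤-trans x≤s s≤r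

  module Extend (P : PartialOutTree) {a b s} (ab : TAdj F a b s) (ex : Exit P a b s)
                (first : ∀ {p q s′} → TAdj F p q s′ → Exit P p q s′ → s ≤ s′) where

    open PartialOutTree P
    private
      Ra = proj₁ ex
      b∉R = proj₁ (proj₂ ex)
      a≤s = proj₂ (proj₂ ex)

    Reached′ : Fin n → Set
    Reached′ x = Reached x ⊎ x ≡ b

    arrival′ : Fin n → ℕ
    arrival′ = updateAt arrival b (const s)

    edges′ : List (TE n)
    edges′ = edgeOf ab ∷ edges

    unreached′ : List (Fin n)
    unreached′ = filter (λ y → ¬? (y ≟ᶠ b)) unreached

    reached≢b : Reached x → x ≢ b
    reached≢b Rx refl = b∉R Rx

    arrival′-b : arrival′ b ≡ s
    arrival′-b = updateAt-updates b arrival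

    arrival′-old : Reached x → arrival′ x ≡ arrival x
    arrival′-old Rx = updateAt-minimal _ b arrival (reached≢b Rx)

    from-arrival′ : Reached x → arrival′ x ≤ s′ → arrival x ≤ s′
    from-arrival′ Rx = subst (_≤ _) (arrival′-old Rx)

    to-arrival′ : Reached x → arrival x ≤ s′ → arrival′ x ≤ s′
    to-arrival′ Rx = subst (_≤ _) (sym (arrival′-old Rx))

    from-arrival′-b : arrival′ b ≤ s′ → s ≤ s′
    from-arrival′-b = subst (_≤ _) arrival′-b

    to-arrival′-b : s ≤ s′ → arrival′ b ≤ s′
    to-arrival′-b = subst (_≤ _) (sym arrival′-b)

    after-b : arrival′ b ≤ s′ → Reached c → arrival′ c ≤ s′
    after-b b≤ Rc = to-arrival′ Rc (≤-trans (exits-late ab Ra b∉R a≤s Rc) (from-arrival′-b b≤))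

    Adj-inside : Adj edges p q → Reached p × Reached q
    Adj-inside (_ , inj₁ pq) = edges-inside pq
    Adj-inside (_ , inj₂ qp) = Product.swap (edges-inside qp)

    leaf : Adj edges′ p b → p ≡ a
    leaf pb with Adj-edgeOf⁻ ab pb
    ... | inj₁ pb′ = ⊥-elim (b∉R (proj₂ (Adj-inside pb′)))
    ... | inj₂ (inj₁ (p≡a , _)) = p≡a
    ... | inj₂ (inj₂ (p≡b , b≡a)) = trans p≡b b≡a

    rest : Adj edges′ p q → p ≢ b → q ≢ b → Adj edges p q
    rest pq p≢b q≢b with Adj-edgeOf⁻ ab pq
    ... | inj₁ pq′ = pq′
    ... | inj₂ (inj₁ (_ , q≡b)) = ⊥-elim (q≢b q≡b)
    ... | inj₂ (inj₂ (p≡b , _)) = ⊥-elim (p≢b p≡b)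

    new-edge-fresh : All (edgeOf ab ≢_) edges
    new-edge-fresh = All.tabulate λ {e} e∈edges new≡e →
      let e-at-b = subst (λ e → Incident e b) new≡e (edgeOf-incident ab)
      in b∉R (Incident-endpoint {e = e} {Q = Reached} e-at-b (edges-inside e∈edges))

    route′ : Reached′ x → ∃ λ vs → TWalkBy edges′ 0 (arrival′ x) r x vs × Unique vs × All Reached′ vs
    route′ (inj₁ Rx) with route Rx
    ... | vs , w , uq , inR =
      vs , TWalkBy-later (≤-reflexive (sym (arrival′-old Rx))) (TWalkBy-mono there w) , uq , All.map inj₁ inR
    route′ (inj₂ refl) with route Ra
    ... | vs , w , uq , inR =
      vs ∷ʳ b ,
      TWalkBy-later (≤-reflexive (sym arrival′-b)) (TWalkBy-snoc (TWalkBy-mono there w) a≤s (TAdj-edgeOf ab)) ,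
      Unique.++⁺ uq ([] ∷ []) (λ { (b∈vs , here refl) → b∉R (All.lookup inR b∈vs) }) ,
      ∷ʳ⁺ (All.map inj₁ inR) (inj₂ refl)

    closed′ : TAdj F p q s′ → Reached′ p → arrival′ p ≤ s′ → Reached′ q → arrival′ q ≤ s′
    closed′ pq (inj₁ Rp)   p≤ (inj₁ Rq)   = to-arrival′ Rq (closed pq Rp (from-arrival′ Rp p≤) Rq)
    closed′ pq (inj₁ Rp)   p≤ (inj₂ refl) = to-arrival′-b (first pq (Rp , b∉R , from-arrival′ Rp p≤))
    closed′ _  (inj₂ refl) p≤ (inj₁ Rq)   = after-b p≤ Rq
    closed′ _  (inj₂ refl) p≤ (inj₂ refl) = p≤

    exits-late′ : TAdj F p q s′ → Reached′ p → ¬ Reached′ q → arrival′ p ≤ s′ →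
                  Reached′ c → arrival′ c ≤ s′
    exits-late′ pq (inj₁ Rp)   q∉R p≤ (inj₁ Rc)   =
      to-arrival′ Rc (exits-late pq Rp (q∉R ∘ inj₁) (from-arrival′ Rp p≤) Rc)
    exits-late′ pq (inj₁ Rp)   q∉R p≤ (inj₂ refl) =
      to-arrival′-b (first pq (Rp , q∉R ∘ inj₁ , from-arrival′ Rp p≤))
    exits-late′ _  (inj₂ refl) _   p≤ (inj₁ Rc)   = after-b p≤ Rc
    exits-late′ _  (inj₂ refl) _   p≤ (inj₂ refl) = p≤

    extended : PartialOutTree
    extended = record
      { Reached = Reached′ ; reached? = λ x → reached? x ⊎-dec (x ≟ᶠ b) ; arrival = arrival′
      ; edges = edges′ ; unreached = unreached′
      ; root-reached = inj₁ root-reached ; arrival-root = trans (arrival′-old root-reached) arrival-root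
      ; edges⊆F = λ { (here refl) → edgeOf∈ ab ; (there e∈) → edges⊆F e∈ }
      ; edges-inside = λ { (here refl) → edgeOf-endpoints {Q = Reached′} ab (inj₁ Ra) (inj₂ refl)
                         ; (there e∈) → Product.map inj₁ inj₁ (edges-inside e∈) }
      ; edges-unique = new-edge-fresh ∷ edges-unique
      ; edges-acyclic = acyclic-leaf leaf rest edges-acyclic
      ; route = route′ ; closed = closed′ ; exits-late = exits-late′
      ; unreached-complete = λ x∉R → ∈-filter⁺ _ (unreached-complete (x∉R ∘ inj₁)) (x∉R ∘ inj₂)
      }

    shrinks : length unreached′ < length unreached
    shrinks = filter-notAll _ unreached (Any.map (λ b≡y y≢b → y≢b (sym b≡y)) (unreached-complete b∉R))

  complete-or-extend : (∀ x → x ≢ r → TPath F r x) → (P : PartialOutTree) →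
                       (∀ x → PartialOutTree.Reached P x) ⊎
                       ∃ λ P′ → length (PartialOutTree.unreached P′) < length (PartialOutTree.unreached P)
  complete-or-extend reach P with least? ≤-totalOrder t (leaving? P) F
  ... | inj₂ none = inj₁ all-reached
    where
    open PartialOutTree P
    all-reached : ∀ x → Reached x
    all-reached x with reached? x | x ≟ᶠ r
    ... | yes Rx  | _        = Rx
    ... | no _    | yes refl = root-reached
    ... | no x∉R  | no x≢r
      with _ , _ , _ , ab , ex ←
             walk-exits P (proj₁ (proj₂ (reach x x≢r))) root-reached (≤-reflexive arrival-root) x∉R
      with _ , e∈F , e-leaves , _ ← exit-leaving P ab ex
      = ⊥-elim (none e∈F e-leaves)
  ... | inj₁ (m , m∈F , m-leaves , m-first)
    with _ , _ , ab , ex ← leaving-exit P m∈F m-leaves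
    = inj₂ (Extend.extended P ab ex first , Extend.shrinks P ab ex first)
    where
    first : ∀ {p q s′} → TAdj F p q s′ → Exit P p q s′ → t m ≤ s′
    first pq pq-exit with _ , e∈F , e-leaves , refl ← exit-leaving P pq pq-exit = m-first e∈F e-leaves

  grow : (∀ x → x ≢ r → TPath F r x) → ∀ k (P : PartialOutTree) → length (PartialOutTree.unreached P) ≤ k →
         Σ PartialOutTree λ P → ∀ x → PartialOutTree.Reached P x
  grow reach k P len with complete-or-extend reach P
  ... | inj₁ complete = P , complete
  grow reach zero    P len | inj₂ (_ , shrinks) = ⊥-elim (<⇒≱ (<-≤-trans shrinks len) z≤n)
  grow reach (suc k) P len | inj₂ (P′ , shrinks) = grow reach k P′ (≤-pred (<-≤-trans shrinks len))

  reach⇒OutTree : (∀ x → x ≢ r → TPath F r x) → ∃ (OutTree F r)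
  reach⇒OutTree reach with grow reach _ start ≤-refl
  ... | P , complete = edges , edges⊆F , edges-unique , (connected , edges-acyclic) , λ x _ → path x
    where
    open PartialOutTree P
    path : ∀ x → TPath edges r x
    path x with vs , w , uq , _ ← route (complete x) = vs , TWalkBy⇒TWalk w , uq
    connected : Connected edges
    connected x y = Walk-++ (proj₂ (Walk-reverse (TWalk⇒Walk (proj₁ (proj₂ (path x))))))
                            (TWalk⇒Walk (proj₁ (proj₂ (path y))))

-- Decomposing a spanner along a vertex cover

module Decompose {n : ℕ} (E : List (TE n)) (X : Subset n) (cover : VertexCover E X)
                 (S : List (TE n)) (S⊑E : S ⊑ E) (S-connected : TemporallyConnected S) where

  open import Data.List.Membership.DecPropositional (_≟ᵉ_ {n}) using () renaming (_∈?_ to _∈ᵉ?_)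

  private variable
    a x y : Fin n
    e : TE n

  S⊆E : S ⊆ E
  S⊆E = ⊑-lookup S⊑E

  earliest? : (a : Fin n) → ∃ (Earliest S a) ⊎ (∀ {e} → e ∈ S → ¬ Incident e a)
  earliest? a = least? ≤-totalOrder t (incident? a) S

  extra : Fin n → Maybe (TE n)
  extra a with a ∈? X | earliest? a
  ... | no _ | inj₁ (e , _) = just e
  ... | _    | _            = nothing

  extra-earliest : extra a ≡ just e → a ∉ₛ X × Earliest S a e
  extra-earliest {a} eq with a ∈? X | earliest? a
  extra-earliest refl | no a∉X | inj₁ (e , earliest) = a∉X , earliest
  extra-earliest ()   | no _   | inj₂ _
  extra-earliest ()   | yes _  | _

  extra-defined : a ∉ₛ X → e ∈ S → Incident e a → ∃ λ e′ → extra a ≡ just e′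
  extra-defined {a} a∉X e∈S e-at-a with a ∈? X | earliest? a
  ... | yes a∈X | _                = ⊥-elim (a∉X a∈X)
  ... | no _    | inj₁ (e′ , _)    = e′ , refl
  ... | no _    | inj₂ no-incident = ⊥-elim (no-incident e∈S e-at-a)

  Extra : TE n → Set
  Extra e = ∃ λ a → extra a ≡ just e

  extra? : Decidable Extra
  extra? e = any? λ a → ≡-dec _≟ᵉ_ (extra a) (just e)

  Extra⊆S : Extra e → e ∈ S
  Extra⊆S (_ , eq) = proj₁ (proj₂ (extra-earliest eq))

  latest-extra : (x : Fin n) → ∃ (Least (Flip.totalOrder ≤-totalOrder) t (λ e → Extra e × Incident e x) S)
                             ⊎ (∀ {e} → e ∈ S → ¬ (Extra e × Incident e x))
  latest-extra x = least? (Flip.totalOrder ≤-totalOrder) t (λ e → extra? e ×-dec incident? x e) S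

  -- x's out-tree only uses edges no earlier than every extra edge at x, so the vertices owning
  -- those extra edges can continue along it.
  τ : Fin n → ℕ
  τ x with latest-extra x
  ... | inj₁ (e , _) = t e
  ... | inj₂ _       = 0

  extra≤τ : extra a ≡ just e → Incident e x → t e ≤ τ x
  extra≤τ {a} {e} {x} eq e-at-x with latest-extra x
  ... | inj₁ (_ , _ , _ , latest) = latest (Extra⊆S (a , eq)) ((a , eq) , e-at-x)
  ... | inj₂ none                 = ⊥-elim (none (Extra⊆S (a , eq)) ((a , eq) , e-at-x))

  reach-from-τ : ∀ x y → ∃ (TWalk S (τ x) x y)
  reach-from-τ x y with latest-extra x
  ... | inj₁ (e , _ , ((a , eq) , e-at-x) , _) = earliest-reach S-connected (proj₂ (extra-earliest eq)) e-at-x y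
  ... | inj₂ _                                 = walk-between S-connected x y

  out-tree : (x : Fin n) → ∃ (OutTree (Late (τ x) S) x)
  out-tree x =
    reach⇒OutTree (Late (τ x) S) x λ y _ → TWalk⇒TPath (TWalk-late ≤-refl (proj₂ (reach-from-τ x y)))

  tree : Fin n → List (TE n)
  tree x = proj₁ (out-tree x)

  tree-isOutTree : (x : Fin n) → OutTree (Late (τ x) S) x (tree x)
  tree-isOutTree x = proj₂ (out-tree x)

  tree⊆S : tree x ⊆ S
  tree⊆S {x} = Late⊆ S ∘ proj₁ (tree-isOutTree x)

  tree-late : e ∈ tree x → τ x ≤ t e
  tree-late {x = x} = Late-≥ S ∘ proj₁ (tree-isOutTree x)

  tree-from-τ : ∀ x y → ∃ (TWalk (tree x) (τ x) x y)
  tree-from-τ x y = Product.map₂ (TWalk-from tree-late) (OutTree-walk (tree-isOutTree x) y)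

  trees : List (Fin n × List (TE n))
  trees = map (λ x → x , tree x) (elements X)

  InTrees : TE n → Set
  InTrees e = Any (λ p → e ∈ proj₂ p) trees

  in-trees : x ∈ₛ X → e ∈ tree x → InTrees e
  in-trees x∈X e∈tree = Any-map⁺ (Any.map (λ { refl → e∈tree }) (∈-elements⁺ x∈X))

  InTrees⊆S : InTrees e → e ∈ S
  InTrees⊆S in-trees = tree⊆S (proj₂ (Any.satisfied (Any-map⁻ in-trees)))

  Covered : TE n → Set
  Covered e = InTrees e ⊎ Extra e

  covered? : Decidable Covered
  covered? e = Any.any? (λ p → e ∈ᵉ? proj₂ p) trees ⊎-dec extra? e

  S′ : List (TE n)
  S′ = filter covered? S

  tree⊆S′ : x ∈ₛ X → tree x ⊆ S′
  tree⊆S′ x∈X e∈tree = ∈-filter⁺ covered? (tree⊆S e∈tree) (inj₁ (in-trees x∈X e∈tree))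

  covered-endpoint : e ∈ E → ∃ λ z → z ∈ₛ X × Incident e z
  covered-endpoint e∈E =
    [ (λ u∈X → _ , u∈X , inj₁ refl) , (λ v∈X → _ , v∈X , inj₂ refl) ] (cover e∈E)

  extra-walk : x ∉ₛ X → extra x ≡ just e → ∀ y → ∃ (TWalk S′ (t e) x y)
  extra-walk {x} x∉X eq y =
    let e∈S , e-at-x , _ = proj₂ (extra-earliest eq)
        z , z∈X , e-at-z = covered-endpoint (S⊆E e∈S)
        x≢z = λ x≡z → x∉X (subst (_∈ₛ X) (sym x≡z) z∈X)
        x→z = TAdj-incident (∈-filter⁺ covered? e∈S (inj₂ (x , eq))) e-at-x e-at-z x≢z
    in Product.map (x ∷_)
                   (step ≤-refl x→z ∘ TWalk-earlier (extra≤τ eq e-at-z) ∘ TWalk-mono (tree⊆S′ z∈X))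
                   (tree-from-τ z y)

  S′-connected : TemporallyConnected S′
  S′-connected x y x≢y = from (x ∈? X)
    where
    via-extra : x ∉ₛ X → (∃ λ e → extra x ≡ just e) → TPath S′ x y
    via-extra x∉X (_ , eq) = TWalk⇒TPath (proj₂ (extra-walk x∉X eq y))
    incident-at-x : (∃ λ e → e ∈ S × Incident e x) → x ∉ₛ X → TPath S′ x y
    incident-at-x (_ , e∈S , e-at-x) x∉X = via-extra x∉X (extra-defined x∉X e∈S e-at-x)
    from : Dec (x ∈ₛ X) → TPath S′ x y
    from (yes x∈X) = TWalk⇒TPath (TWalk-mono (tree⊆S′ x∈X) (proj₂ (tree-from-τ x y)))
    from (no x∉X)  = incident-at-x (TPath-incident (S-connected x y x≢y) x≢y) x∉X

  S′-spanner : ∀ {T T′} → T′ ≤ T → (∀ {e} → e ∈ S → t e ≤ T′) → IsSpanner T E T′ S′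
  S′-spanner T′≤T labels =
    ⊑-trans (filter-⊆ covered? S) S⊑E , T′≤T , labels ∘ proj₁ ∘ ∈-filter⁻ covered? {xs = S} , S′-connected

  minimum⇒covered : length S ≤ length S′ → e ∈ S → Covered e
  minimum⇒covered {e} minimum e∈S = decide (covered? e)
    where
    decide : Dec (Covered e) → Covered e
    decide (yes covered)  = covered
    decide (no uncovered) =
      ⊥-elim (<⇒≱ (filter-notAll covered? S (Any.map (λ { refl → uncovered }) e∈S)) minimum)

lemma9 : ∀ {n} (T : ℕ) (E : List (TE n)) → IsTGraph T E → Happy E → TemporallyConnected E →
         (X : Subset n) (d : ℕ) → ∣ X ∣ ≡ d → VertexCover E X →
         (T' : ℕ) (S : List (TE n)) → IsMinimumSpanner T E T' S →
         Decomposition E X d S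
lemma9 T E _ _ _ X d |X|≡d cover T' S ((S⊑E , T'≤T , S-labels , S-connected) , minimum) =
  trees , few-trees , All-map⁺ (All.map tree-valid (elements-inside X)) ,
  extra , (λ _ _ eq → Product.map₂ (proj₁ ∘ proj₂) (extra-earliest eq)) ,
  λ e → mk⇔ (minimum⇒covered (minimum T' S′ (S′-spanner T'≤T S-labels))) [ InTrees⊆S , Extra⊆S ]
  where
  open Decompose E X cover S S⊑E S-connected
  few-trees : length trees ≤ d
  few-trees = ≤-reflexive (trans (length-map _ (elements X)) (trans (length-elements X) |X|≡d))
  tree-valid : ∀ {x} → x ∈ₛ X → x ∈ₛ X × OutTree E x (tree x)
  tree-valid {x} x∈X = x∈X , OutTree-mono (S⊆E ∘ Late⊆ S) (tree-isOutTree x)
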